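{- Let $D$ be an extended semicomplete digraph and let $C_1^g$ and $C_2^g$ be vertex-disjoint G-cycles of $D$ which both contain a vertex from the same partite set $V$ of $D$. Then $D$ has a G-cycle $C^g$ with $V(C^g)=V(C_1^g)\cup V(C_2^g)$ and $\ell(C^g)=\ell(C_1^g)+\ell(C_2^g)$.
   Context: All digraphs are finite, without loops or parallel arcs (2-cycles allowed). A semicomplete digraph has at least one arc between every two distinct vertices. $D$ is an extended semicomplete digraph if there are a semicomplete digraph $S$ on $\{1,\ldots,s\}$ and integers $n_1,\ldots,n_s\ge1$ such that $D$ is obtained by replacing each vertex $i$ of $S$ by an independent set $I_i$ of $n_i$ vertices and, for every arc $ij$ of $S$, adding all arcs from $I_i$ to $I_j$; the $I_i$ are the partite sets of $D$. A G-cycle of $D$ is either a directed cycle of $D$, or a sequence of $r\ge1$ pairwise vertex-disjoint directed paths $P_1,\ldots,P_r$ of $D$ (a path may be a single vertex), $P_i$ from $u_i$ to $v_i$, such that $v_i$ and $u_{i+1}$ lie in the same partite set for every $i\in[r]$, where $u_{r+1}=u_1$. Its length $\ell$ is the number of arcs of $D$ it uses. -}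

module Defs where

open import Data.Nat using (ℕ; suc; _≤_)
open import Data.Fin using (Fin)
open import Data.Bool using (Bool; true; false)
open import Data.Product using (Σ; ∃; ∃-syntax; _×_; _,_; proj₁)
open import Data.Sum using (_⊎_)
open import Data.List using (List; []; _∷_; _++_; [_]; length; map; concatMap)
open import Data.Nat.ListAction using (sum)
open import Data.List.NonEmpty using (List⁺; _∷_; toList) renaming (head to head⁺; last to last⁺; tail to tail⁺)
open import Data.List.Relation.Unary.All using (All)
open import Data.List.Relation.Unary.Linked using (Linked)
open import Data.List.Relation.Unary.Unique.Propositional using (Unique)
open import Data.List.Membership.Propositional using (_∈_)
open import Relation.Binary.PropositionalEquality using (_≡_; _≢_)

-- An extended semicomplete digraph, given by the semicomplete digraph S on Fin s
-- (adjacency matrix adj; no loops; every two distinct vertices joined by an arc)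
-- and the sizes n i ≥ 1 of the independent sets I_i replacing vertex i.
record ExtSemicomplete : Set where
  field
    s           : ℕ
    n           : Fin s → ℕ
    n-pos       : ∀ i → 1 ≤ n i
    adj         : Fin s → Fin s → Bool
    loopless    : ∀ i → adj i i ≡ false
    semicomplete : ∀ i j → i ≢ j → (adj i j ≡ true) ⊎ (adj j i ≡ true)

module _ (D : ExtSemicomplete) where
  open ExtSemicomplete D

  -- vertices of D: the vertex (i , k) is the k-th vertex of the partite set I_i
  Vertex : Set
  Vertex = Σ (Fin s) (λ i → Fin (n i))

  part : Vertex → Fin s
  part = proj₁

  Arc : Vertex → Vertex → Set
  Arc u v = adj (part u) (part v) ≡ true

  IsPath : List⁺ Vertex → Set
  IsPath p = Linked Arc (toList p)

  Joins : List⁺ Vertex → List⁺ Vertex → Set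
  Joins p q = part (last⁺ p) ≡ part (head⁺ q)

  data GCycle : Set where
    dcycle : (x : Vertex) (xs : List Vertex) →
             Unique (x ∷ xs) → Linked Arc (x ∷ xs ++ [ x ]) → GCycle
    -- r ≥ 1 pairwise vertex-disjoint paths P₁ = p, P₂, …, P_r (ps = P₂ … P_r),
    -- with end of P_i and start of P_{i+1} (cyclically) in the same partite set
    gpaths : (p : List⁺ Vertex) (ps : List (List⁺ Vertex)) →
             All IsPath (p ∷ ps) →
             Unique (concatMap toList (p ∷ ps)) →
             Linked Joins (p ∷ ps ++ [ p ]) → GCycle

  vertices : GCycle → List Vertex
  vertices (dcycle x xs _ _) = x ∷ xs
  vertices (gpaths p ps _ _ _) = concatMap toList (p ∷ ps)

  len : GCycle → ℕ
  len (dcycle x xs _ _) = length (x ∷ xs)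
  len (gpaths p ps _ _ _) = sum (map (λ q → length (tail⁺ q)) (p ∷ ps))

{-# OPTIONS --safe #-}
-- Read a G-cycle as a closed walk: a cyclic sequence of distinct vertices in which each vertex
-- is followed either by an out-neighbour (an arc step, counted by the length) or by a vertex of
-- its own partite set (a jump from the end of one path to the start of the next).  Whether a
-- step u → v is allowed depends on v only through its partite set.  So if x ∈ C₁ and y ∈ C₂ lie
-- in the same partite set, rotate the two walks to start at x and y and concatenate them: the
-- step that returned to x now enters y and vice versa.  The result is a closed walk through
-- V(C₁) ∪ V(C₂) with ℓ(C₁) + ℓ(C₂) arc steps; cutting it after each jump (or, when it has no
-- jump, reading it as a directed cycle) gives the required G-cycle.
module Submission where

open import Defs
open import Data.Nat using (ℕ; suc; _+_)
open import Data.Bool using (true)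
open import Data.Product using (_×_; _,_; ∃-syntax; proj₁; proj₂; map₂)
open import Data.Sum using (_⊎_; inj₁; inj₂)
open import Data.Unit using (⊤; tt)
open import Data.Empty using (⊥)
open import Data.List using (List; []; _∷_; _++_; [_]; length; map; concatMap; initLast; _∷ʳ′_)
open import Data.List.Properties using (++-identityʳ; map-++; map-∘; map-id)
open import Data.Nat.ListAction using (sum)
open import Data.Nat.ListAction.Properties using (sum-++; sum-↭)
open import Data.List.NonEmpty using (List⁺; _∷_; toList) renaming (head to head⁺; last to last⁺; tail to tail⁺)
open import Data.List.Relation.Unary.All using (All; []; _∷_)
open import Data.List.Relation.Unary.Any using (here; there)
open import Data.List.Relation.Unary.Linked using (Linked; [-]; _∷_)
open import Data.List.Relation.Unary.Unique.Propositional using (Unique)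
import Data.List.Relation.Unary.Unique.Propositional.Properties as Unique
open import Data.List.Relation.Binary.Disjoint.Propositional using (Disjoint)
open import Data.List.Membership.Propositional using (_∈_; _∉_)
open import Data.List.Membership.Propositional.Properties using (∈-map⁻; ∈-∃++; ++-∈⇔)
open import Data.List.Relation.Binary.Permutation.Propositional using (_↭_; ↭-sym; ↭-trans; ↭-reflexive; ↭⇒↭ₛ)
open import Data.List.Relation.Binary.Permutation.Propositional.Properties using (∈-resp-↭; ++-comm; ++⁺; map⁺)
import Data.List.Relation.Binary.Permutation.Setoid.Properties as Permutationₛ
open import Relation.Binary.PropositionalEquality using (_≡_; refl; sym; trans; cong; cong₂; subst; setoid)
open import Function using (_∘_)
open import Function.Bundles using (_⇔_; mk⇔)
open import Function.Construct.Composition using (_⇔-∘_)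

last⁺-∷ : ∀ {A : Set} (a b : A) bs → last⁺ (a ∷ b ∷ bs) ≡ last⁺ (b ∷ bs)
last⁺-∷ a b bs with initLast bs
... | []        = refl
... | _ ∷ʳ′ _   = refl

Linked-resp-head : ∀ {A : Set} {R : A → A → Set} {x y : A} {xs} →
                   (∀ {z} → R x z → R y z) → Linked R (x ∷ xs) → Linked R (y ∷ xs)
Linked-resp-head f [-]      = [-]
Linked-resp-head f (r ∷ rs) = f r ∷ rs

Unique-resp-↭ : ∀ {A : Set} {xs ys : List A} → xs ↭ ys → Unique xs → Unique ys
Unique-resp-↭ {A} p = Permutationₛ.Unique-resp-↭ (setoid A) (↭⇒↭ₛ p)

↭-++-∈⇔ : ∀ {A : Set} {zs xs ys : List A} → zs ↭ xs ++ ys → ∀ x → x ∈ zs ⇔ (x ∈ xs ⊎ x ∈ ys)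
↭-++-∈⇔ p x = ++-∈⇔ ⇔-∘ mk⇔ (∈-resp-↭ p) (∈-resp-↭ (↭-sym p))

data Step : Set where
  arc jump : Step

stepLength : Step → ℕ
stepLength arc  = 1
stepLength jump = 0

module _ (D : ExtSemicomplete) where
  open ExtSemicomplete D using (adj)

  -- An entry (v , t) records the kind t of the step leaving v for the next vertex of the walk.
  Walk : Set
  Walk = List (Vertex D × Step)

  Leads : Step → Vertex D → Vertex D → Set
  Leads arc  u v = Arc D u v
  Leads jump u v = part D u ≡ part D v

  Leads-resp-part : ∀ t {u v w} → part D v ≡ part D w → Leads t u v → Leads t u w
  Leads-resp-part arc  {u} eq l = subst (λ i → adj (part D u) i ≡ true) eq l
  Leads-resp-part jump     eq l = trans l eq

  headOr : Walk → Vertex D → Vertex D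
  headOr []            z = z
  headOr ((v , _) ∷ _) _ = v

  WalkTo : Walk → Vertex D → Set
  WalkTo []            z = ⊤
  WalkTo ((v , t) ∷ L) z = Leads t v (headOr L z) × WalkTo L z

  WalkTo-++⁻ : ∀ L M {z} → WalkTo (L ++ M) z → WalkTo L (headOr M z) × WalkTo M z
  WalkTo-++⁻ []                M w       = tt , w
  WalkTo-++⁻ ((v , t) ∷ [])    M (l , w) = (l , tt) , w
  WalkTo-++⁻ ((v , t) ∷ e ∷ L) M (l , w) =
    let wL , wM = WalkTo-++⁻ (e ∷ L) M w in (l , wL) , wM

  WalkTo-++⁺ : ∀ L M {z} → WalkTo L (headOr M z) → WalkTo M z → WalkTo (L ++ M) z
  WalkTo-++⁺ []                M _        wM = wM
  WalkTo-++⁺ ((v , t) ∷ [])    M (l , _)  wM = l , wM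
  WalkTo-++⁺ ((v , t) ∷ e ∷ L) M (l , wL) wM = l , WalkTo-++⁺ (e ∷ L) M wL wM

  WalkTo-resp-part : ∀ L {z w} → part D z ≡ part D w → WalkTo L z → WalkTo L w
  WalkTo-resp-part []                eq _       = tt
  WalkTo-resp-part ((v , t) ∷ [])    eq (l , _) = Leads-resp-part t eq l , tt
  WalkTo-resp-part ((v , t) ∷ e ∷ L) eq (l , w) = l , WalkTo-resp-part (e ∷ L) eq w

  Closed : Walk → Set
  Closed []            = ⊥
  Closed ((v , t) ∷ L) = WalkTo ((v , t) ∷ L) v

  Closed-rotate : ∀ L M → Closed (L ++ M) → Closed (M ++ L)
  Closed-rotate L       []      c = subst Closed (++-identityʳ L) c
  Closed-rotate []      (f ∷ M) c = subst Closed (sym (++-identityʳ (f ∷ M))) c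
  Closed-rotate (e ∷ L) (f ∷ M) c =
    let wL , wM = WalkTo-++⁻ (e ∷ L) (f ∷ M) c in WalkTo-++⁺ (f ∷ M) (e ∷ L) wM wL

  Closed-++ : ∀ {x t y s} R S → part D x ≡ part D y →
              Closed ((x , t) ∷ R) → Closed ((y , s) ∷ S) → Closed ((x , t) ∷ R ++ (y , s) ∷ S)
  Closed-++ {x} {t} {y} {s} R S eq cR cS =
    WalkTo-++⁺ ((x , t) ∷ R) ((y , s) ∷ S)
      (WalkTo-resp-part ((x , t) ∷ R) eq cR) (WalkTo-resp-part ((y , s) ∷ S) (sym eq) cS)

  Closed-∷ʳ-jump⁻ : ∀ L w → Closed (L ++ [ (w , jump) ]) → WalkTo L w × part D w ≡ part D (headOr L w)
  Closed-∷ʳ-jump⁻ []      w _ = tt , refl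
  Closed-∷ʳ-jump⁻ (e ∷ L) w c = let wL , (j , _) = WalkTo-++⁻ (e ∷ L) [ (w , jump) ] c in wL , j

  rotateToHead : ∀ {L e} → e ∈ L → Closed L → ∃[ R ] (e ∷ R ↭ L × Closed (e ∷ R))
  rotateToHead {e = e} e∈L c with ∈-∃++ e∈L
  ... | A , B , refl = B ++ A , ++-comm (e ∷ B) A , Closed-rotate A (e ∷ B) c

  rotateToLast : ∀ {L e} → e ∈ L → Closed L → ∃[ R ] (R ++ [ e ] ↭ L × Closed (R ++ [ e ]))
  rotateToLast {e = e} e∈L c with rotateToHead e∈L c
  ... | R , eR↭L , cR = R , ↭-trans (++-comm R [ e ]) eR↭L , Closed-rotate [ e ] R cR

  support : Walk → List (Vertex D)
  support = map proj₁

  arcCount : Walk → ℕ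
  arcCount L = sum (map (stepLength ∘ proj₂) L)

  arcCount-++ : ∀ L M → arcCount (L ++ M) ≡ arcCount L + arcCount M
  arcCount-++ L M = trans (cong sum (map-++ _ L M)) (sum-++ (map _ L) (map _ M))

  arcCount-↭ : ∀ {L M} → L ↭ M → arcCount L ≡ arcCount M
  arcCount-↭ p = sum-↭ (map⁺ _ p)

  Closed-merge : ∀ L M {x y} → x ∈ support L → y ∈ support M → part D x ≡ part D y →
                 Closed L → Closed M → ∃[ N ] (N ↭ L ++ M × Closed N)
  Closed-merge L M x∈L y∈M eq cL cM with ∈-map⁻ proj₁ x∈L | ∈-map⁻ proj₁ y∈M
  ... | (x , t) , x∈ , refl | (y , s) , y∈ , refl
    with rotateToHead x∈ cL | rotateToHead y∈ cM
  ... | R , R↭L , cR | S , S↭M , cS = _ , ++⁺ R↭L S↭M , Closed-++ R S eq cR cS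

  arcWalk : List (Vertex D) → Walk
  arcWalk = map (_, arc)

  support-arcWalk : ∀ xs → support (arcWalk xs) ≡ xs
  support-arcWalk xs = trans (sym (map-∘ xs)) (map-id xs)

  arcCount-arcWalk : ∀ xs → arcCount (arcWalk xs) ≡ length xs
  arcCount-arcWalk []       = refl
  arcCount-arcWalk (x ∷ xs) = cong suc (arcCount-arcWalk xs)

  WalkTo-arcWalk⁺ : ∀ xs {z} → Linked (Arc D) (xs ++ [ z ]) → WalkTo (arcWalk xs) z
  WalkTo-arcWalk⁺ []           _        = tt
  WalkTo-arcWalk⁺ (x ∷ [])     (a ∷ _)  = a , tt
  WalkTo-arcWalk⁺ (x ∷ y ∷ xs) (a ∷ as) = a , WalkTo-arcWalk⁺ (y ∷ xs) as

  WalkTo-arcWalk⁻ : ∀ xs {z} → WalkTo (arcWalk xs) z → Linked (Arc D) (xs ++ [ z ])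
  WalkTo-arcWalk⁻ []           _        = [-]
  WalkTo-arcWalk⁻ (x ∷ [])     (a , _)  = a ∷ [-]
  WalkTo-arcWalk⁻ (x ∷ y ∷ xs) (a , as) = a ∷ WalkTo-arcWalk⁻ (y ∷ xs) as

  pathWalkFrom : Vertex D → List (Vertex D) → Walk
  pathWalkFrom a []       = (a , jump) ∷ []
  pathWalkFrom a (b ∷ bs) = (a , arc) ∷ pathWalkFrom b bs

  pathWalk : List⁺ (Vertex D) → Walk
  pathWalk (a ∷ as) = pathWalkFrom a as

  support-pathWalk : ∀ a as → support (pathWalk (a ∷ as)) ≡ a ∷ as
  support-pathWalk a []       = refl
  support-pathWalk a (b ∷ bs) = cong (a ∷_) (support-pathWalk b bs)

  arcCount-pathWalk : ∀ a as → arcCount (pathWalk (a ∷ as)) ≡ length as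
  arcCount-pathWalk a []       = refl
  arcCount-pathWalk a (b ∷ bs) = cong suc (arcCount-pathWalk b bs)

  headOr-pathWalk : ∀ a as {z} → headOr (pathWalk (a ∷ as)) z ≡ a
  headOr-pathWalk a []      = refl
  headOr-pathWalk a (_ ∷ _) = refl

  WalkTo-pathWalk : ∀ a as {z} → IsPath D (a ∷ as) → part D (last⁺ (a ∷ as)) ≡ part D z →
                    WalkTo (pathWalk (a ∷ as)) z
  WalkTo-pathWalk a []       _          eq = eq , tt
  WalkTo-pathWalk a (b ∷ bs) (ab ∷ bbs) eq =
    subst (Arc D a) (sym (headOr-pathWalk b bs)) ab ,
    WalkTo-pathWalk b bs bbs (trans (cong (part D) (sym (last⁺-∷ a b bs))) eq)

  pathsWalk : List (List⁺ (Vertex D)) → Walk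
  pathsWalk = concatMap pathWalk

  WalkTo-pathsWalk : ∀ ps r → All (IsPath D) ps → Linked (Joins D) (ps ++ [ r ]) →
                     WalkTo (pathsWalk ps) (head⁺ r)
  WalkTo-pathsWalk []           r _         _         = tt
  WalkTo-pathsWalk (p ∷ [])     r (pp ∷ _)  (j ∷ [-]) =
    WalkTo-++⁺ (pathWalk p) [] (WalkTo-pathWalk (head⁺ p) (tail⁺ p) pp j) tt
  WalkTo-pathsWalk (p ∷ q ∷ ps) r (pp ∷ pps) (j ∷ js) =
    WalkTo-++⁺ (pathWalk p) (pathsWalk (q ∷ ps))
      (subst (WalkTo (pathWalk p)) (sym (headOr-pathsWalk q ps))
        (WalkTo-pathWalk (head⁺ p) (tail⁺ p) pp j))
      (WalkTo-pathsWalk (q ∷ ps) r pps js)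
    where
    headOr-pathsWalk : ∀ q ps {z} → headOr (pathsWalk (q ∷ ps)) z ≡ head⁺ q
    headOr-pathsWalk (a ∷ [])     ps = refl
    headOr-pathsWalk (a ∷ b ∷ bs) ps = refl

  support-pathsWalk : ∀ ps → support (pathsWalk ps) ≡ concatMap toList ps
  support-pathsWalk []       = refl
  support-pathsWalk (p ∷ ps) =
    trans (map-++ proj₁ (pathWalk p) (pathsWalk ps))
          (cong₂ _++_ (support-pathWalk (head⁺ p) (tail⁺ p)) (support-pathsWalk ps))

  arcCount-pathsWalk : ∀ ps → arcCount (pathsWalk ps) ≡ sum (map (length ∘ tail⁺) ps)
  arcCount-pathsWalk []       = refl
  arcCount-pathsWalk (p ∷ ps) =
    trans (arcCount-++ (pathWalk p) (pathsWalk ps))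
          (cong₂ _+_ (arcCount-pathWalk (head⁺ p) (tail⁺ p)) (arcCount-pathsWalk ps))

  walkOf : GCycle D → Walk
  walkOf (dcycle x xs _ _)   = arcWalk (x ∷ xs)
  walkOf (gpaths p ps _ _ _) = pathsWalk (p ∷ ps)

  Closed-walkOf : ∀ C → Closed (walkOf C)
  Closed-walkOf (dcycle x xs _ l)                = WalkTo-arcWalk⁺ (x ∷ xs) l
  -- p is split only so that walkOf C reduces to a cons, as Closed requires.
  Closed-walkOf (gpaths p@(a ∷ [])    ps pp _ j) = WalkTo-pathsWalk (p ∷ ps) p pp j
  Closed-walkOf (gpaths p@(a ∷ _ ∷ _) ps pp _ j) = WalkTo-pathsWalk (p ∷ ps) p pp j

  support-walkOf : ∀ C → support (walkOf C) ≡ vertices D C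
  support-walkOf (dcycle x xs _ _)   = support-arcWalk (x ∷ xs)
  support-walkOf (gpaths p ps _ _ _) = support-pathsWalk (p ∷ ps)

  arcCount-walkOf : ∀ C → arcCount (walkOf C) ≡ len D C
  arcCount-walkOf (dcycle x xs _ _)   = arcCount-arcWalk (x ∷ xs)
  arcCount-walkOf (gpaths p ps _ _ _) = arcCount-pathsWalk (p ∷ ps)

  Unique-vertices : ∀ C → Unique (vertices D C)
  Unique-vertices (dcycle _ _ u _)   = u
  Unique-vertices (gpaths _ _ _ u _) = u

  record Represents (C : GCycle D) (L : Walk) : Set where
    constructor _,_
    field
      vertices-↭ : vertices D C ↭ support L
      len-≡      : len D C ≡ arcCount L

  Represents-resp-↭ : ∀ {C L M} → L ↭ M → Represents C L → Represents C M
  Represents-resp-↭ p (vs , ℓ) = ↭-trans vs (map⁺ proj₁ p) , trans ℓ (arcCount-↭ p)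

  dcycleOf : ∀ x xs → Closed (arcWalk (x ∷ xs)) → Unique (x ∷ xs) →
             ∃[ C ] Represents C (arcWalk (x ∷ xs))
  dcycleOf x xs c u =
    dcycle x xs u (WalkTo-arcWalk⁻ (x ∷ xs) c) ,
    ↭-reflexive (sym (support-arcWalk (x ∷ xs))) , sym (arcCount-arcWalk (x ∷ xs))

  -- The closed walk L ++ [ (w , jump) ] cut after each of its jumps.
  segments : Walk → Vertex D → List⁺ (List⁺ (Vertex D))
  segments []              w = (w ∷ []) ∷ []
  segments ((v , jump) ∷ L) w = (v ∷ []) ∷ toList (segments L w)
  segments ((v , arc)  ∷ L) w =
    let S = segments L w in (v ∷ toList (head⁺ S)) ∷ tail⁺ S

  head-segments : ∀ L w → head⁺ (head⁺ (segments L w)) ≡ headOr L w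
  head-segments []               w = refl
  head-segments ((v , jump) ∷ L) w = refl
  head-segments ((v , arc)  ∷ L) w = refl

  concat-segments : ∀ L w → concatMap toList (toList (segments L w)) ≡ support (L ++ [ (w , jump) ])
  concat-segments []               w = refl
  concat-segments ((v , jump) ∷ L) w = cong (v ∷_) (concat-segments L w)
  concat-segments ((v , arc)  ∷ L) w = cong (v ∷_) (concat-segments L w)

  arcCount-segments : ∀ L w → sum (map (length ∘ tail⁺) (toList (segments L w))) ≡
                              arcCount (L ++ [ (w , jump) ])
  arcCount-segments []               w = refl
  arcCount-segments ((v , jump) ∷ L) w = arcCount-segments L w
  arcCount-segments ((v , arc)  ∷ L) w = cong suc (arcCount-segments L w)

  All-IsPath-segments : ∀ L w → WalkTo L w → All (IsPath D) (toList (segments L w))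
  All-IsPath-segments []               w _        = [-] ∷ []
  All-IsPath-segments ((v , jump) ∷ L) w (_ , wL) = [-] ∷ All-IsPath-segments L w wL
  All-IsPath-segments ((v , arc)  ∷ L) w (a , wL) with All-IsPath-segments L w wL
  ... | pS ∷ pSs = (subst (Arc D v) (sym (head-segments L w)) a ∷ pS) ∷ pSs

  Joins-segments : ∀ L w p → WalkTo L w → part D w ≡ part D (head⁺ p) →
                   Linked (Joins D) (toList (segments L w) ++ [ p ])
  Joins-segments []               w p _        eq = eq ∷ [-]
  Joins-segments ((v , jump) ∷ L) w p (j , wL) eq =
    trans j (cong (part D) (sym (head-segments L w))) ∷ Joins-segments L w p wL eq
  Joins-segments ((v , arc)  ∷ L) w p (_ , wL) eq =
    Linked-resp-head (subst (λ u → part D u ≡ _) (sym (last⁺-∷ v (head⁺ S₁) (tail⁺ S₁))))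
      (Joins-segments L w p wL eq)
    where S₁ = head⁺ (segments L w)

  gpathsOf : ∀ L w → Closed (L ++ [ (w , jump) ]) → Unique (support (L ++ [ (w , jump) ])) →
             ∃[ C ] Represents C (L ++ [ (w , jump) ])
  gpathsOf L w c u =
    gpaths (head⁺ S) (tail⁺ S) (All-IsPath-segments L w wL)
      (subst Unique (sym (concat-segments L w)) u)
      (Joins-segments L w (head⁺ S) wL (trans j (cong (part D) (sym (head-segments L w))))) ,
    ↭-reflexive (concat-segments L w) , arcCount-segments L w
    where
    S = segments L w
    wL = proj₁ (Closed-∷ʳ-jump⁻ L w c)
    j = proj₂ (Closed-∷ʳ-jump⁻ L w c)

  arcWalk-or-jump : ∀ L → L ≡ arcWalk (support L) ⊎ ∃[ w ] (w , jump) ∈ L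
  arcWalk-or-jump []               = inj₁ refl
  arcWalk-or-jump ((v , jump) ∷ L) = inj₂ (v , here refl)
  arcWalk-or-jump ((v , arc)  ∷ L) with arcWalk-or-jump L
  ... | inj₁ eq       = inj₁ (cong ((v , arc) ∷_) eq)
  ... | inj₂ (w , w∈) = inj₂ (w , there w∈)

  fromClosedWalk : ∀ L → Closed L → Unique (support L) → ∃[ C ] Represents C L
  fromClosedWalk L@((x , _) ∷ L′) c u with arcWalk-or-jump L
  ... | inj₁ eq =
    subst (λ M → ∃[ C ] Represents C M) (sym eq) (dcycleOf x (support L′) (subst Closed eq c) u)
  ... | inj₂ (w , w∈L) with rotateToLast w∈L c
  ...   | R , R↭L , cR =
    map₂ (Represents-resp-↭ R↭L) (gpathsOf R w cR (Unique-resp-↭ (map⁺ proj₁ (↭-sym R↭L)) u))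

  support-walkOf-++ : ∀ C₁ C₂ → support (walkOf C₁ ++ walkOf C₂) ≡ vertices D C₁ ++ vertices D C₂
  support-walkOf-++ C₁ C₂ =
    trans (map-++ proj₁ (walkOf C₁) (walkOf C₂)) (cong₂ _++_ (support-walkOf C₁) (support-walkOf C₂))

  arcCount-walkOf-++ : ∀ C₁ C₂ → arcCount (walkOf C₁ ++ walkOf C₂) ≡ len D C₁ + len D C₂
  arcCount-walkOf-++ C₁ C₂ =
    trans (arcCount-++ (walkOf C₁) (walkOf C₂)) (cong₂ _+_ (arcCount-walkOf C₁) (arcCount-walkOf C₂))

  Unique-support-walkOf-++ : ∀ C₁ C₂ → Disjoint (vertices D C₁) (vertices D C₂) →
                             Unique (support (walkOf C₁ ++ walkOf C₂))
  Unique-support-walkOf-++ C₁ C₂ disjoint = subst Unique (sym (support-walkOf-++ C₁ C₂))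
    (Unique.++⁺ (Unique-vertices C₁) (Unique-vertices C₂) disjoint)

  GCycle-merge : ∀ (C₁ C₂ : GCycle D) {x y} → Disjoint (vertices D C₁) (vertices D C₂) →
                 x ∈ vertices D C₁ → y ∈ vertices D C₂ → part D x ≡ part D y →
                 ∃[ C ] (vertices D C ↭ vertices D C₁ ++ vertices D C₂ × len D C ≡ len D C₁ + len D C₂)
  GCycle-merge C₁ C₂ disjoint x∈C₁ y∈C₂ eq
    with Closed-merge (walkOf C₁) (walkOf C₂)
           (subst (_ ∈_) (sym (support-walkOf C₁)) x∈C₁)
           (subst (_ ∈_) (sym (support-walkOf C₂)) y∈C₂)
           eq (Closed-walkOf C₁) (Closed-walkOf C₂)
  ... | N , N↭ , cN
    with fromClosedWalk N cN
           (Unique-resp-↭ (map⁺ proj₁ (↭-sym N↭)) (Unique-support-walkOf-++ C₁ C₂ disjoint))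
  ... | C , rep with Represents-resp-↭ N↭ rep
  ... | C↭ , lenC = C , ↭-trans C↭ (↭-reflexive (support-walkOf-++ C₁ C₂)) ,
                       trans lenC (arcCount-walkOf-++ C₁ C₂)

lemma6p2 : (D : ExtSemicomplete) (C₁ C₂ : GCycle D) →
    (∀ x → x ∈ vertices D C₁ → x ∉ vertices D C₂) →
    (∃[ x ] ∃[ y ] (x ∈ vertices D C₁ × y ∈ vertices D C₂ × part D x ≡ part D y)) →
    ∃[ C ] ((∀ x → x ∈ vertices D C ⇔ (x ∈ vertices D C₁ ⊎ x ∈ vertices D C₂))
            × len D C ≡ len D C₁ + len D C₂)
lemma6p2 D C₁ C₂ disjoint (x , y , x∈C₁ , y∈C₂ , samePart) =
  let C , C↭ , lenC = GCycle-merge D C₁ C₂ (λ (u∈C₁ , u∈C₂) → disjoint _ u∈C₁ u∈C₂) x∈C₁ y∈C₂ samePart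
  in C , ↭-++-∈⇔ C↭ , lenC
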